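{- There is no family $\{\Gamma_i: i\in\mathbb{N}\}$ of spanning subgraphs of the countably infinite complete graph $K_{\mathbb{N}}$, each isomorphic to $S_2$, whose edge sets partition $E(K_{\mathbb{N}})$.
   Context: The countable star $S_1$ is the graph with vertex set $\mathbb{N}$ and edges $\{0,i\}$, $i\ge1$. $S_2$ is the vertex-disjoint union of two copies of $S_1$. -}

module Defs where

open import Data.Nat using (ℕ)
open import Data.Bool using (Bool)
open import Data.Product using (Σ; ∃; _×_; _,_)
open import Data.Sum using (_⊎_)
open import Relation.Binary.PropositionalEquality using (_≡_; _≢_)
open import Function.Bundles using (_⤖_; _⇔_; Bijection)

Graph : Set → Set₁
Graph V = V → V → Set

S₁ : Graph ℕ
S₁ m n = (m ≡ 0 × n ≢ 0) ⊎ (n ≡ 0 × m ≢ 0)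

-- S₂: vertex-disjoint union of two copies of S₁ (vertex set Bool × ℕ).
S₂V : Set
S₂V = Bool × ℕ

S₂ : Graph S₂V
S₂ (b , m) (c , n) = (b ≡ c) × S₁ m n

_≅_ : {V W : Set} → Graph V → Graph W → Set
_≅_ {V} {W} G H =
  Σ (V ⤖ W) λ f → ∀ u v → G u v ⇔ H (Bijection.to f u) (Bijection.to f v)

EdgePartition : (ℕ → Graph ℕ) → Set
EdgePartition Γ =
  ∀ x y → x ≢ y → Σ ℕ λ i → Γ i x y × (∀ j → Γ j x y → j ≡ i)

{-# OPTIONS --safe #-}
-- Every edge of a copy of S₂ has one of its two centres as an endpoint, so among any three
-- vertices of K_ℕ two are centres of some copy. Let a, b be the centres of Γ₀; the edge ab lies
-- in a copy Γⱼ with (say) a as a centre, whose other centre is e. Call x a spoke if ax ∈ Γ₀ and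
-- x ≠ e. Tracking which copy contains ex, ay and ey shows that a spoke x which is a centre of Γₖ
-- has its partner in {a, e}; hence x is joined in Γₖ to every other spoke, and no two spokes are
-- both centres. But a has infinitely many spokes, so three of them contradict the first remark.
module Submission where

open import Defs
open import Data.Bool using (Bool; true; false; not)
open import Data.Bool.Properties using (not-¬; not-involutive)
open import Data.Empty using (⊥; ⊥-elim)
open import Data.Fin using (Fin; zero; suc; toℕ; punchIn)
open import Data.Fin.Properties using (toℕ-injective; punchIn-injective; punchInᵢ≢i; any?)
open import Data.Nat using (ℕ; zero; suc)
open import Data.Nat.Properties using (_≟_; suc-injective)
open import Data.Product using (Σ; ∃; ∃₂; _×_; _,_; proj₁; proj₂)
open import Data.Product.Properties using (,-injectiveˡ; ,-injectiveʳ)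
open import Data.Sum using (_⊎_; inj₁; inj₂; [_,_]′)
import Data.Sum as Sum
open import Function using (_∘_; id)
open import Function.Bundles using (Bijection; Inverse; Equivalence)
open import Function.Definitions using (Injective)
open import Function.Properties.Bijection using (⤖⇒↔)
open import Relation.Binary.Definitions using (DecidableEquality)
open import Relation.Binary.PropositionalEquality
  using (_≡_; _≢_; refl; sym; trans; cong; subst; ≢-sym)
open import Relation.Nullary using (¬_; yes; no)

S₁-sym : ∀ {m n} → S₁ m n → S₁ n m
S₁-sym (inj₁ p) = inj₂ p
S₁-sym (inj₂ p) = inj₁ p

S₁-irrefl : ∀ {m} → ¬ S₁ m m
S₁-irrefl (inj₁ (m≡0 , m≢0)) = m≢0 m≡0
S₁-irrefl (inj₂ (m≡0 , m≢0)) = m≢0 m≡0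

S₁-hub : ∀ {m n} → S₁ m n → m ≡ 0 ⊎ n ≡ 0
S₁-hub (inj₁ (m≡0 , _)) = inj₁ m≡0
S₁-hub (inj₂ (n≡0 , _)) = inj₂ n≡0

S₂-sym : ∀ {p q} → S₂ p q → S₂ q p
S₂-sym (b≡c , s) = sym b≡c , S₁-sym s

S₂-irrefl : ∀ {p} → ¬ S₂ p p
S₂-irrefl (_ , s) = S₁-irrefl s

S₂-hub-leaf : ∀ b m → S₂ (b , 0) (b , suc m)
S₂-hub-leaf b m = refl , inj₁ (refl , λ ())

same-or-opposite : ∀ b c → c ≡ b ⊎ c ≡ not b
same-or-opposite true  true  = inj₁ refl
same-or-opposite true  false = inj₂ refl
same-or-opposite false true  = inj₂ refl
same-or-opposite false false = inj₁ refl

avoiding-punchIn : ∀ {n} {A : Set} → DecidableEquality A → {f : Fin (suc n) → A} →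
                   Injective _≡_ _≡_ f → ∀ z → ∃ λ i → ∀ j → f (punchIn i j) ≢ z
avoiding-punchIn _≟ᴬ_ {f} f-inj z with any? (λ i → f i ≟ᴬ z)
... | yes (i , fi≡z) = i , λ j e → punchInᵢ≢i i j (f-inj (trans e (sym fi≡z)))
... | no ∄          = zero , λ j e → ∄ (punchIn zero j , e)

module DoubleStar {G : Graph ℕ} (φ : S₂ ≅ G) where

  open Inverse (⤖⇒↔ (proj₁ φ)) using (to; from; strictlyInverseˡ)

  preserves : ∀ {p q} → S₂ p q → G (to p) (to q)
  preserves = Equivalence.to (proj₂ φ _ _)

  reflects : ∀ {p q} → G (to p) (to q) → S₂ p q
  reflects = Equivalence.from (proj₂ φ _ _)

  data Image : ℕ → Set where
    image : ∀ p → Image (to p)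

  image-of : ∀ v → Image v
  image-of v = subst Image (strictlyInverseˡ v) (image (from v))

  centre : Bool → ℕ
  centre b = to (b , 0)

  Centres : ℕ → ℕ → Set
  Centres a o = Σ Bool λ b → a ≡ centre b × o ≡ centre (not b)

  symmetric : ∀ {u v} → G u v → G v u
  symmetric {u} {v} g with image-of u | image-of v
  ... | image p | image q = preserves (S₂-sym (reflects g))

  irreflexive : ∀ {v} → ¬ G v v
  irreflexive {v} g with image-of v
  ... | image p = S₂-irrefl (reflects g)

  centres : Centres (centre true) (centre false)
  centres = true , refl , refl

  Centres-swap : ∀ {a o} → Centres a o → Centres o a
  Centres-swap (b , refl , refl) = not b , refl , cong centre (sym (not-involutive b))

  Centres-distinct : ∀ {a o} → Centres a o → a ≢ o
  Centres-distinct (b , refl , refl) e =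
    not-¬ refl (,-injectiveˡ (Bijection.injective (proj₁ φ) e))

  Centres-nonadjacent : ∀ {a o} → Centres a o → ¬ G a o
  Centres-nonadjacent (b , refl , refl) g = not-¬ refl (proj₁ (reflects g))

  Centres-unique : ∀ {a o x y} → Centres a o → Centres x y → x ≡ a ⊎ x ≡ o
  Centres-unique (b , refl , refl) (c , refl , _) =
    Sum.map (cong centre) (cong centre) (same-or-opposite b c)

  Centres-leaf : ∀ {a o v} → Centres a o → v ≢ a → v ≢ o → G v a ⊎ G v o
  Centres-leaf {v = v} (b , refl , refl) v≢a v≢o with image-of v
  ... | image (c , m) with same-or-opposite b c | m
  ...   | inj₁ refl | zero  = ⊥-elim (v≢a refl)
  ...   | inj₂ refl | zero  = ⊥-elim (v≢o refl)
  ...   | inj₁ refl | suc n = inj₁ (preserves (S₂-sym (S₂-hub-leaf b n)))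
  ...   | inj₂ refl | suc n = inj₂ (preserves (S₂-sym (S₂-hub-leaf (not b) n)))

  edge-has-centre : ∀ {u v} → G u v → ∃ (Centres u) ⊎ ∃ (Centres v)
  edge-has-centre {u} {v} g with image-of u | image-of v
  ... | image (b , m) | image (c , n) with S₁-hub (proj₂ (reflects g))
  ...   | inj₁ refl = inj₁ (_ , b , refl , refl)
  ...   | inj₂ refl = inj₂ (_ , c , refl , refl)

  Centres-spokes : ∀ {a o} → Centres a o →
                   Σ (ℕ → ℕ) λ f → Injective _≡_ _≡_ f × (∀ n → G a (f n))
  Centres-spokes (b , refl , refl) =
    (λ n → to (b , suc n)) ,
    (λ e → suc-injective (,-injectiveʳ (Bijection.injective (proj₁ φ) e))) ,
    (λ n → preserves (S₂-hub-leaf b n))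

module _ (Γ : ℕ → Graph ℕ) (copies : ∀ k → S₂ ≅ Γ k) (partition : EdgePartition Γ) where

  module Star (k : ℕ) = DoubleStar {Γ k} (copies k)
  open Star using (Centres)

  IsCentre : ℕ → Set
  IsCentre x = ∃₂ λ k y → Centres k x y

  adjacent⇒distinct : ∀ {k u v} → Γ k u v → u ≢ v
  adjacent⇒distinct {k} g refl = Star.irreflexive k g

  edge-unique : ∀ {k m u v} → Γ k u v → Γ m u v → k ≡ m
  edge-unique {k} {m} g g′ with partition _ _ (adjacent⇒distinct g)
  ... | _ , _ , unique = trans (unique k g) (sym (unique m g′))

  edge-elsewhere : ∀ {k m u v} → Γ m u v → k ≢ m → ¬ Γ k u v
  edge-elsewhere g k≢m g′ = k≢m (edge-unique g′ g)

  distinct-has-centre : ∀ {x y} → x ≢ y → IsCentre x ⊎ IsCentre y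
  distinct-has-centre x≢y with partition _ _ x≢y
  ... | k , g , _ = Sum.map (k ,_) (k ,_) (Star.edge-has-centre k g)

  leaf-of-other-centre : ∀ {k a o v} → Centres k a o → v ≢ a → v ≢ o → ¬ Γ k v a → Γ k v o
  leaf-of-other-centre {k} ao v≢a v≢o ¬va = [ ⊥-elim ∘ ¬va , id ]′ (Star.Centres-leaf k ao v≢a v≢o)

  module Spokes {i a b} (ab : Centres i a b) {j} (a-b : Γ j a b) {e} (ae : Centres j a e) where

    Spoke : ℕ → Set
    Spoke x = Γ i a x × x ≢ e

    j≢i : j ≢ i
    j≢i refl = Star.Centres-nonadjacent i ab a-b

    spoke-adjacent-e : ∀ {x} → Spoke x → Γ j e x
    spoke-adjacent-e (a-x , x≢e) = Star.symmetric j
      (leaf-of-other-centre ae (≢-sym (adjacent⇒distinct a-x)) x≢e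
        (edge-elsewhere (Star.symmetric i a-x) j≢i))

    spoke-centre-≢i : ∀ {x k y} → Spoke x → Centres k x y → k ≢ i
    spoke-centre-≢i (a-x , _) xy refl with Star.Centres-unique i ab xy
    ... | inj₁ refl = Star.irreflexive i a-x
    ... | inj₂ refl = Star.Centres-nonadjacent i ab a-x

    spoke-centre-≢j : ∀ {x k y} → Spoke x → Centres k x y → k ≢ j
    spoke-centre-≢j (a-x , x≢e) xy refl with Star.Centres-unique j ae xy
    ... | inj₁ refl = Star.irreflexive i a-x
    ... | inj₂ refl = x≢e refl

    spoke-centre-partner : ∀ {x k y} → Spoke x → Centres k x y → y ≡ a ⊎ y ≡ e
    spoke-centre-partner {k = k} {y = y} sx@(a-x , x≢e) xy with y ≟ a | y ≟ e
    ... | yes y≡a | _       = inj₁ y≡a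
    ... | no _    | yes y≡e = inj₂ y≡e
    ... | no y≢a  | no y≢e  = ⊥-elim
      ([ edge-elsewhere (spoke-adjacent-e sx) k≢j , edge-elsewhere (Star.symmetric j y-e) k≢j ]′
         (Star.Centres-leaf k xy (x≢e ∘ sym) (≢-sym y≢e)))
      where
      k≢j : k ≢ j
      k≢j = spoke-centre-≢j sx xy

      a-y : Γ k a y
      a-y = leaf-of-other-centre xy (adjacent⇒distinct a-x) (≢-sym y≢a)
              (edge-elsewhere a-x (spoke-centre-≢i sx xy))

      y-e : Γ j y e
      y-e = leaf-of-other-centre ae y≢a y≢e (edge-elsewhere (Star.symmetric k a-y) (k≢j ∘ sym))

    spoke-≢-partner : ∀ {x k y x′} → Spoke x → Centres k x y → Spoke x′ → x′ ≢ y
    spoke-≢-partner sx xy (a-x′ , x′≢e) with spoke-centre-partner sx xy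
    ... | inj₁ refl = ≢-sym (adjacent⇒distinct a-x′)
    ... | inj₂ refl = x′≢e

    spoke-centre-adjacent : ∀ {x k y x′} → Spoke x → Centres k x y → Spoke x′ → x′ ≢ x → Γ k x x′
    spoke-centre-adjacent {k = k} sx xy sx′ x′≢x =
      Star.symmetric k (leaf-of-other-centre (Star.Centres-swap k xy) (spoke-≢-partner sx xy sx′) x′≢x ¬x′-y)
      where
      ¬x′-y : ¬ Γ k _ _
      ¬x′-y with spoke-centre-partner sx xy
      ... | inj₁ refl = edge-elsewhere (Star.symmetric i (proj₁ sx′)) (spoke-centre-≢i sx xy)
      ... | inj₂ refl = edge-elsewhere (Star.symmetric j (spoke-adjacent-e sx′)) (spoke-centre-≢j sx xy)

    spokes-not-both-centres : ∀ {x x′} → Spoke x → Spoke x′ → x ≢ x′ → IsCentre x → ¬ IsCentre x′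
    spokes-not-both-centres sx sx′ x≢x′ (k , y , xy) (m , y′ , x′y′)
      with edge-unique (spoke-centre-adjacent sx xy sx′ (≢-sym x≢x′))
                       (Star.symmetric m (spoke-centre-adjacent sx′ x′y′ sx x≢x′))
    ... | refl with Star.Centres-unique k xy x′y′
    ...   | inj₁ x′≡x = x≢x′ (sym x′≡x)
    ...   | inj₂ x′≡y = spoke-≢-partner sx xy sx′ x′≡y

    no-three-spokes : (x : Fin 3 → ℕ) → Injective _≡_ _≡_ x → (∀ n → Spoke (x n)) → ⊥
    no-three-spokes x x-inj spoke =
      pigeonhole (one-centre 0₃ 1₃ (λ ())) (one-centre 1₃ 2₃ (λ ())) (one-centre 0₃ 2₃ (λ ()))
      where
      0₃ 1₃ 2₃ : Fin 3
      0₃ = zero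
      1₃ = suc zero
      2₃ = suc (suc zero)

      one-centre : ∀ m n → m ≢ n → IsCentre (x m) ⊎ IsCentre (x n)
      one-centre m n m≢n = distinct-has-centre (m≢n ∘ x-inj)

      not-both : ∀ m n → m ≢ n → IsCentre (x m) → ¬ IsCentre (x n)
      not-both m n m≢n = spokes-not-both-centres (spoke m) (spoke n) (m≢n ∘ x-inj)

      pigeonhole : IsCentre (x 0₃) ⊎ IsCentre (x 1₃) → IsCentre (x 1₃) ⊎ IsCentre (x 2₃) →
                   IsCentre (x 0₃) ⊎ IsCentre (x 2₃) → ⊥
      pigeonhole (inj₁ c₀) (inj₁ c₁) _         = not-both 0₃ 1₃ (λ ()) c₀ c₁
      pigeonhole (inj₁ c₀) (inj₂ c₂) _         = not-both 0₃ 2₃ (λ ()) c₀ c₂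
      pigeonhole (inj₂ c₁) _         (inj₁ c₀) = not-both 0₃ 1₃ (λ ()) c₀ c₁
      pigeonhole (inj₂ c₁) _         (inj₂ c₂) = not-both 1₃ 2₃ (λ ()) c₁ c₂

    impossible : ⊥
    impossible with Star.Centres-spokes i ab
    ... | f , f-inj , a-f with avoiding-punchIn _≟_ (toℕ-injective ∘ f-inj) e
    ...   | p , avoids-e =
      no-three-spokes (f ∘ toℕ ∘ punchIn p) (punchIn-injective p _ _ ∘ toℕ-injective ∘ f-inj)
        (λ n → a-f _ , avoids-e n)

  no-edge-partition : ⊥
  no-edge-partition with partition _ _ (Star.Centres-distinct 0 (Star.centres 0))
  ... | j , a-b , _ with Star.edge-has-centre j a-b
  ...   | inj₁ (_ , ae) = Spokes.impossible (Star.centres 0) a-b ae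
  ...   | inj₂ (_ , be) = Spokes.impossible (Star.Centres-swap 0 (Star.centres 0)) (Star.symmetric j a-b) be

proposition4p4 : ¬ (Σ (ℕ → Graph ℕ) λ Γ → (∀ i → S₂ ≅ Γ i) × EdgePartition Γ)
proposition4p4 (Γ , copies , partition) = no-edge-partition Γ copies partition
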